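{- Let $\Sigma$ be a finite totally ordered alphabet and let $\mathcal{M}=(T_1,\dots,T_m)$ be a collection (multiset, given in some order) of nonempty strings over $\Sigma$. Then for every $d\in\{1,\dots,m\}$: (1) $\mathrm{BWT}(T_d)$ is a subsequence of $\mathrm{EBWT}(\mathcal{M})$; (2) $\mathrm{BWT}(T_d\$)$ is a subsequence of $\mathrm{dolEBWT}(\mathcal{M})$; (3) $\mathrm{BWT}(T_d\$)$ is a subsequence of $\mathrm{mdolEBWT}(\mathcal{M})$, up to renaming the character $\$$; (4) $\mathrm{BWT}(T_d\$)$ is a subsequence of $\mathrm{mdolBWT}(\mathcal{M})$, up to renaming the character $\$$; (5) $\mathrm{BWT}(T_d\$)$ is a subsequence of $\mathrm{concatBWT}(\mathcal{M})$, up to renaming the character $\$$.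
   Context: A conjugate (rotation) of $T=T[1..n]$ is $T[i..n]T[1..i-1]$ for some $i$. For a string $T$, $\mathrm{BWT}(T)$ is the string formed by the last characters of all $n$ conjugates of $T$ listed in lexicographic order. A string $S$ is a subsequence of $T$ if $S$ is obtained from $T$ by deleting zero or more characters without changing the order of the rest. For a string $T$, $T^\omega$ is the infinite concatenation $TTT\cdots$; every $T$ equals $U^k$ for a unique primitive $U$ and integer $k=\exp(T)$. The omega-order: $S\prec_\omega T$ iff $S^\omega<_{\mathrm{lex}}T^\omega$, or $S^\omega=T^\omega$ and $\exp(S)<\exp(T)$. $\mathrm{EBWT}$ of a multiset of strings is the concatenation of the last characters of all conjugates of all strings of the multiset, listed in omega-order (ties broken by index of the string, then position of the rotation). Separator symbols: a symbol $\$$, and symbols $\$_1<\$_2<\dots<\$_m$, all smaller than every character of $\Sigma$; a symbol $\#$ smaller than all of these. $\mathrm{dolEBWT}(\mathcal{M})=\mathrm{EBWT}(\{T_d\$ : 1\le d\le m\})$ (same symbol $\$$ for all strings). $\mathrm{mdolEBWT}(\mathcal{M})=\mathrm{EBWT}(\{T_d\$_d : 1\le d\le m\})$. $\mathrm{mdolBWT}(\mathcal{M})=\mathrm{BWT}(T_1\$_1T_2\$_2\cdots T_m\$_m)$. $\mathrm{concatBWT}(\mathcal{M})=\mathrm{BWT}(T_1\$T_2\$\cdots T_m\$\#)$. "Up to renaming the character $\$$" means the subsequence relation holds after the occurrence of $\$$ in $\mathrm{BWT}(T_d\$)$ is allowed to be matched with a separator symbol (some $\$_j$, $\$$, or $\#$)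 of the larger transform. -}

module Defs where

open import Data.Nat using (ℕ; zero; suc; _<_; _≤_; _+_)
open import Data.Fin as Fin using (Fin)
open import Data.List using (List; []; _∷_; _++_; map; drop; take; length; upTo; concat; replicate; last)
open import Data.List.Relation.Unary.Linked using (Linked)
open import Data.List.Relation.Binary.Permutation.Propositional using (_↭_)
open import Data.List.Relation.Binary.Pointwise using (Pointwise)
open import Data.List.Relation.Binary.Sublist.Heterogeneous using (Sublist)
open import Data.Maybe using (Maybe; just; nothing)
open import Data.Product using (Σ; ∃; _×_; _,_)
open import Data.Sum using (_⊎_)
open import Relation.Binary.PropositionalEquality using (_≡_)
open import Relation.Nullary using (¬_)

-- Symbols: the alphabet Σ is Fin σ (with its natural total order),
-- extended by the separator symbols  #  <  $  <  $_1 < $_2 < ...  <  Σ.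
-- ($ and the $_j never occur together in one string, so their relative
-- order is immaterial.)

data Sym (σ : ℕ) : Set where
  hash  : Sym σ
  dol   : Sym σ
  dolI  : ℕ → Sym σ          -- dolI j is $_j  (1-based index j)
  ch    : Fin σ → Sym σ

data _<ₛ_ {σ : ℕ} : Sym σ → Sym σ → Set where
  #<$   : hash <ₛ dol
  #<$ᵢ  : ∀ {j} → hash <ₛ dolI j
  #<c   : ∀ {a} → hash <ₛ ch a
  $<$ᵢ  : ∀ {j} → dol <ₛ dolI j
  $<c   : ∀ {a} → dol <ₛ ch a
  $ᵢ<$ⱼ : ∀ {i j} → i < j → dolI i <ₛ dolI j
  $ᵢ<c  : ∀ {j a} → dolI j <ₛ ch a
  c<c   : ∀ {a b} → a Fin.< b → ch a <ₛ ch b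

IsSep : {σ : ℕ} → Sym σ → Set
IsSep s = s ≡ dol ⊎ (∃ λ j → s ≡ dolI j) ⊎ s ≡ hash

data _<ₗ_ {σ : ℕ} : List (Sym σ) → List (Sym σ) → Set where
  []<∷  : ∀ {y ys} → [] <ₗ (y ∷ ys)
  here  : ∀ {x y xs ys} → x <ₛ y → (x ∷ xs) <ₗ (y ∷ ys)
  there : ∀ {x xs ys} → xs <ₗ ys → (x ∷ xs) <ₗ (x ∷ ys)

_≤ₗ_ : {σ : ℕ} → List (Sym σ) → List (Sym σ) → Set
S ≤ₗ T = S ≡ T ⊎ S <ₗ T

rot : {A : Set} → ℕ → List A → List A
rot i T = drop i T ++ take i T

IsSortedLasts : {A K : Set} → (K → K → Set) → (K → List A) → List K → List A → Set
IsSortedLasts {A} {K} ord str keys L =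
  Σ (List K) λ p → (p ↭ keys) × Linked ord p × Pointwise (λ k c → last (str k) ≡ just c) p L

-- IsBWT T L  :  L = BWT(T)  (last characters of the conjugates of T in
-- lexicographic order; equal conjugates have equal last characters, so
-- this determines L uniquely).
IsBWT : {σ : ℕ} → List (Sym σ) → List (Sym σ) → Set
IsBWT T L = IsSortedLasts (λ i j → rot i T ≤ₗ rot j T) (λ i → rot i T) (upTo (length T)) L

nth : {A : Set} → List A → ℕ → Maybe A
nth []       _       = nothing
nth (x ∷ xs) zero    = just x
nth (x ∷ xs) (suc k) = nth xs k

-- k-th character (0-based) of S^ω  (for nonempty S)
omega : {A : Set} → List A → ℕ → Maybe A
omega S k = nth (concat (replicate (suc k) S)) k

data _<ₘ_ {σ : ℕ} : Maybe (Sym σ) → Maybe (Sym σ) → Set where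
  just< : ∀ {a b} → a <ₛ b → just a <ₘ just b

_<ω_ : {σ : ℕ} → List (Sym σ) → List (Sym σ) → Set
S <ω T = ∃ λ k → (∀ j → j < k → omega S j ≡ omega T j) × (omega S k <ₘ omega T k)

_≡ω_ : {σ : ℕ} → List (Sym σ) → List (Sym σ) → Set
S ≡ω T = ∀ k → omega S k ≡ omega T k

pow : {A : Set} → List A → ℕ → List A
pow U k = concat (replicate k U)

Primitive : {A : Set} → List A → Set
Primitive U = (U ≢[] ) × ¬ (∃ λ V → ∃ λ k → 2 ≤ k × U ≡ pow V k)
  where
    _≢[] : List _ → Set
    W ≢[] = ¬ (W ≡ [])

IsExp : {A : Set} → List A → ℕ → Set
IsExp S k = ∃ λ U → Primitive U × S ≡ pow U k

_≺ω_ : {σ : ℕ} → List (Sym σ) → List (Sym σ) → Set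
S ≺ω T = S <ω T ⊎ (S ≡ω T × ∃ λ a → ∃ λ b → IsExp S a × IsExp T b × a < b)

nthStr : {A : Set} → List (List A) → ℕ → List A
nthStr []       _       = []
nthStr (x ∷ xs) zero    = x
nthStr (x ∷ xs) (suc k) = nthStr xs k

-- all conjugate indices (d , i): string d (0-based), rotation i (0-based)
idxFrom : {A : Set} → ℕ → List (List A) → List (ℕ × ℕ)
idxFrom d []       = []
idxFrom d (T ∷ Ts) = map (λ i → (d , i)) (upTo (length T)) ++ idxFrom (suc d) Ts

conj : {A : Set} → List (List A) → ℕ × ℕ → List A
conj M (d , i) = rot i (nthStr M d)

_◁[_]_ : {σ : ℕ} → ℕ × ℕ → List (List (Sym σ)) → ℕ × ℕ → Set
(d , i) ◁[ M ] (e , j) =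
  conj M (d , i) ≺ω conj M (e , j)
  ⊎ (¬ (conj M (d , i) ≺ω conj M (e , j)) × ¬ (conj M (e , j) ≺ω conj M (d , i))
     × (d < e ⊎ (d ≡ e × i < j)))

IsEBWT : {σ : ℕ} → List (List (Sym σ)) → List (Sym σ) → Set
IsEBWT M L = IsSortedLasts (λ x y → x ◁[ M ] y) (conj M) (idxFrom 0 M) L

embed : {σ : ℕ} → List (Fin σ) → List (Sym σ)
embed = map ch

embedAll : {σ : ℕ} → List (List (Fin σ)) → List (List (Sym σ))
embedAll = map embed

dollar : {σ : ℕ} → List (Sym σ) → List (Sym σ)
dollar T = T ++ dol ∷ []

multiDollarFrom : {σ : ℕ} → ℕ → List (List (Sym σ)) → List (List (Sym σ))
multiDollarFrom j []       = []
multiDollarFrom j (T ∷ Ts) = (T ++ dolI j ∷ []) ∷ multiDollarFrom (suc j) Ts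

multiDollar : {σ : ℕ} → List (List (Sym σ)) → List (List (Sym σ))
multiDollar = multiDollarFrom 1

IsDolEBWT : {σ : ℕ} → List (List (Fin σ)) → List (Sym σ) → Set
IsDolEBWT M L = IsEBWT (map dollar (embedAll M)) L

IsMdolEBWT : {σ : ℕ} → List (List (Fin σ)) → List (Sym σ) → Set
IsMdolEBWT M L = IsEBWT (multiDollar (embedAll M)) L

IsMdolBWT : {σ : ℕ} → List (List (Fin σ)) → List (Sym σ) → Set
IsMdolBWT M L = IsBWT (concat (multiDollar (embedAll M))) L

IsConcatBWT : {σ : ℕ} → List (List (Fin σ)) → List (Sym σ) → Set
IsConcatBWT M L = IsBWT (concat (map dollar (embedAll M)) ++ hash ∷ []) L

Subseq : {σ : ℕ} → List (Sym σ) → List (Sym σ) → Set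
Subseq = Sublist _≡_

-- subsequence up to renaming $: an occurrence of $ may be matched by
-- any separator symbol
RenSep : {σ : ℕ} → Sym σ → Sym σ → Set
RenSep a b = a ≡ b ⊎ (a ≡ dol × IsSep b)

SubseqRen : {σ : ℕ} → List (Sym σ) → List (Sym σ) → Set
SubseqRen = Sublist RenSep

NonEmpty : {A : Set} → List A → Set
NonEmpty T = ¬ (T ≡ [])

-- The rotations of T_d (or T_d$) reappear among the rotations sorted by each larger
-- transform: as the conjugates (d, i) in the extended BWTs, and as the rotations starting
-- inside T_d in the BWTs of concatenations. There they keep the relative order they have in
-- BWT(T_d$): on strings of equal length the omega-order is the lexicographic order, and two
-- rotations starting inside T_d are told apart by the first separator. Their last characters
-- agree too, except that the $ ending T_d$ meets the separator preceding T_d. Reading off the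
-- last characters of just these rotations exhibits BWT(T_d) as a subsequence.
module Submission where

open import Defs
open import Data.Empty using (⊥-elim)
open import Data.Fin using (Fin)
import Data.Fin.Properties as Fin
open import Data.List using (List; []; _∷_; _++_; map; drop; take; length; upTo; concat; last; mapMaybe)
import Data.List.Properties as List
open import Data.List.Membership.Propositional using (_∈_)
import Data.List.Membership.Propositional.Properties as Membership
open import Data.List.Relation.Binary.Permutation.Propositional using (_↭_; ↭-trans; ↭-sym; ↭-reflexive; ↭⇒↭ₛ)
import Data.List.Relation.Binary.Permutation.Propositional.Properties as Perm
open import Data.List.Relation.Binary.Pointwise as Pointwise using (Pointwise; []; _∷_)
open import Data.List.Relation.Binary.Sublist.Heterogeneous using (Sublist; []; _∷_; _∷ʳ_)
open import Data.List.Relation.Unary.All as All using (All; []; _∷_)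
import Data.List.Relation.Unary.All.Properties as All
open import Data.List.Relation.Unary.AllPairs using (AllPairs; []; _∷_)
open import Data.List.Relation.Unary.Linked using (Linked; []; [-]; _∷_)
import Data.List.Relation.Unary.Linked.Properties as Linked
import Data.List.Relation.Unary.Sorted.TotalOrder.Properties as Sorted
open import Data.Maybe using (Maybe; just; nothing)
import Data.Maybe as Maybe using (map)
import Data.Maybe.Properties as Maybe using (just-injective)
import Data.Maybe.Relation.Unary.All as Maybe using (All; just; nothing; drop-just)
open import Data.Nat using (ℕ; zero; suc; _<_; _≤_; _+_; _*_; z≤n; s≤s; _≟_)
import Data.Nat.Properties as ℕ
open import Data.Product using (∃; _×_; _,_)
open import Data.Sum using (_⊎_; inj₁; inj₂; [_,_])
open import Function using (_∘_; id)
open import Level using (0ℓ)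
open import Relation.Binary.Bundles using (TotalOrder)
open import Relation.Binary.Definitions using (Tri; tri<; tri≈; tri>)
open import Relation.Binary.PropositionalEquality using (_≡_; refl; sym; trans; cong; cong₂; subst; subst₂; isEquivalence; module ≡-Reasoning)
open import Relation.Nullary using (¬_; yes; no)

-- Lexicographic order

module _ {σ : ℕ} where

  <ₛ-irrefl : {a : Sym σ} → ¬ a <ₛ a
  <ₛ-irrefl ($ᵢ<$ⱼ i<i) = ℕ.<-irrefl refl i<i
  <ₛ-irrefl (c<c a<a)   = Fin.<-irrefl refl a<a

  <ₛ-trans : {a b c : Sym σ} → a <ₛ b → b <ₛ c → a <ₛ c
  <ₛ-trans #<$       $<$ᵢ      = #<$ᵢ
  <ₛ-trans #<$       $<c       = #<c
  <ₛ-trans #<$ᵢ      ($ᵢ<$ⱼ _) = #<$ᵢ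
  <ₛ-trans #<$ᵢ      $ᵢ<c      = #<c
  <ₛ-trans #<c       (c<c _)   = #<c
  <ₛ-trans $<$ᵢ      ($ᵢ<$ⱼ _) = $<$ᵢ
  <ₛ-trans $<$ᵢ      $ᵢ<c      = $<c
  <ₛ-trans $<c       (c<c _)   = $<c
  <ₛ-trans ($ᵢ<$ⱼ p) ($ᵢ<$ⱼ q) = $ᵢ<$ⱼ (ℕ.<-trans p q)
  <ₛ-trans ($ᵢ<$ⱼ _) $ᵢ<c      = $ᵢ<c
  <ₛ-trans $ᵢ<c      (c<c _)   = $ᵢ<c
  <ₛ-trans (c<c p)   (c<c q)   = c<c (Fin.<-trans p q)

  Tri-image : {A : Set} {_≺_ : A → A → Set} {x y : A} (f : A → Sym σ) →
              (∀ {x y} → x ≺ y → f x <ₛ f y) → Tri (x ≺ y) (x ≡ y) (y ≺ x) →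
              f x <ₛ f y ⊎ f x ≡ f y ⊎ f y <ₛ f x
  Tri-image f mono (tri< x≺y _ _) = inj₁ (mono x≺y)
  Tri-image f mono (tri≈ _ refl _) = inj₂ (inj₁ refl)
  Tri-image f mono (tri> _ _ y≺x) = inj₂ (inj₂ (mono y≺x))

  <ₛ-compare : (a b : Sym σ) → a <ₛ b ⊎ a ≡ b ⊎ b <ₛ a
  <ₛ-compare hash     hash     = inj₂ (inj₁ refl)
  <ₛ-compare hash     dol      = inj₁ #<$
  <ₛ-compare hash     (dolI _) = inj₁ #<$ᵢ
  <ₛ-compare hash     (ch _)   = inj₁ #<c
  <ₛ-compare dol      hash     = inj₂ (inj₂ #<$)
  <ₛ-compare dol      dol      = inj₂ (inj₁ refl)
  <ₛ-compare dol      (dolI _) = inj₁ $<$ᵢ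
  <ₛ-compare dol      (ch _)   = inj₁ $<c
  <ₛ-compare (dolI _) hash     = inj₂ (inj₂ #<$ᵢ)
  <ₛ-compare (dolI _) dol      = inj₂ (inj₂ $<$ᵢ)
  <ₛ-compare (dolI i) (dolI j) = Tri-image dolI $ᵢ<$ⱼ (ℕ.<-cmp i j)
  <ₛ-compare (dolI _) (ch _)   = inj₁ $ᵢ<c
  <ₛ-compare (ch _)   hash     = inj₂ (inj₂ #<c)
  <ₛ-compare (ch _)   dol      = inj₂ (inj₂ $<c)
  <ₛ-compare (ch _)   (dolI _) = inj₂ (inj₂ $ᵢ<c)
  <ₛ-compare (ch a)   (ch b)   = Tri-image ch c<c (Fin.<-cmp a b)

  <ₗ-irrefl : {S : List (Sym σ)} → ¬ S <ₗ S
  <ₗ-irrefl (here a<a)  = <ₛ-irrefl a<a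
  <ₗ-irrefl (there S<S) = <ₗ-irrefl S<S

  <ₗ-trans : {S T U : List (Sym σ)} → S <ₗ T → T <ₗ U → S <ₗ U
  <ₗ-trans []<∷      (here _)  = []<∷
  <ₗ-trans []<∷      (there _) = []<∷
  <ₗ-trans (here p)  (here q)  = here (<ₛ-trans p q)
  <ₗ-trans (here p)  (there _) = here p
  <ₗ-trans (there _) (here q)  = here q
  <ₗ-trans (there p) (there q) = there (<ₗ-trans p q)

  <ₗ-compare : (S T : List (Sym σ)) → S <ₗ T ⊎ S ≡ T ⊎ T <ₗ S
  <ₗ-compare []      []      = inj₂ (inj₁ refl)
  <ₗ-compare []      (_ ∷ _) = inj₁ []<∷
  <ₗ-compare (_ ∷ _) []      = inj₂ (inj₂ []<∷)
  <ₗ-compare (x ∷ S) (y ∷ T) with <ₛ-compare x y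
  ... | inj₁ x<y        = inj₁ (here x<y)
  ... | inj₂ (inj₂ y<x) = inj₂ (inj₂ (here y<x))
  ... | inj₂ (inj₁ refl) with <ₗ-compare S T
  ...   | inj₁ S<T         = inj₁ (there S<T)
  ...   | inj₂ (inj₁ refl) = inj₂ (inj₁ refl)
  ...   | inj₂ (inj₂ T<S)  = inj₂ (inj₂ (there T<S))

  ≮ₗ⇒≤ₗ : (S T : List (Sym σ)) → ¬ T <ₗ S → S ≤ₗ T
  ≮ₗ⇒≤ₗ S T T≮S with <ₗ-compare S T
  ... | inj₁ S<T        = inj₂ S<T
  ... | inj₂ (inj₁ S≡T) = inj₁ S≡T
  ... | inj₂ (inj₂ T<S) = ⊥-elim (T≮S T<S)

  ≤ₗ-trans : {S T U : List (Sym σ)} → S ≤ₗ T → T ≤ₗ U → S ≤ₗ U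
  ≤ₗ-trans (inj₁ refl) T≤U         = T≤U
  ≤ₗ-trans (inj₂ S<T)  (inj₁ refl) = inj₂ S<T
  ≤ₗ-trans (inj₂ S<T)  (inj₂ T<U)  = inj₂ (<ₗ-trans S<T T<U)

  ≤ₗ-antisym : {S T : List (Sym σ)} → S ≤ₗ T → T ≤ₗ S → S ≡ T
  ≤ₗ-antisym (inj₁ S≡T) _          = S≡T
  ≤ₗ-antisym (inj₂ _)   (inj₁ T≡S) = sym T≡S
  ≤ₗ-antisym (inj₂ S<T) (inj₂ T<S) = ⊥-elim (<ₗ-irrefl (<ₗ-trans S<T T<S))

  ≤ₗ-total : (S T : List (Sym σ)) → S ≤ₗ T ⊎ T ≤ₗ S
  ≤ₗ-total S T with <ₗ-compare S T
  ... | inj₁ S<T        = inj₁ (inj₂ S<T)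
  ... | inj₂ (inj₁ S≡T) = inj₁ (inj₁ S≡T)
  ... | inj₂ (inj₂ T<S) = inj₂ (inj₂ T<S)

  ≤ₗ-totalOrder : TotalOrder 0ℓ 0ℓ 0ℓ
  ≤ₗ-totalOrder = record
    { Carrier      = List (Sym σ)
    ; _≈_          = _≡_
    ; _≤_          = _≤ₗ_
    ; isTotalOrder = record
      { isPartialOrder = record
        { isPreorder = record { isEquivalence = isEquivalence ; reflexive = inj₁ ; trans = ≤ₗ-trans }
        ; antisym    = ≤ₗ-antisym }
      ; total = ≤ₗ-total } }

  ↗↭↗⇒≡ : {xs ys : List (List (Sym σ))} → Linked _≤ₗ_ xs → Linked _≤ₗ_ ys → xs ↭ ys → xs ≡ ys
  ↗↭↗⇒≡ xs↗ ys↗ xs↭ys = Pointwise.Pointwise-≡⇒≡ (Sorted.↗↭↗⇒≋ ≤ₗ-totalOrder xs↗ ys↗ (↭⇒↭ₛ xs↭ys))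

-- Infinite words

module _ {σ : ℕ} where

  Word : Set
  Word = ℕ → Maybe (Sym σ)

  Defined : Word → Set
  Defined f = ∀ k → ∃ λ a → f k ≡ just a

  LessAt : Word → Word → ℕ → Set
  LessAt f g k = (∀ j → j < k → f j ≡ g j) × f k <ₘ g k

  _<ˢ_ : Word → Word → Set
  f <ˢ g = ∃ (LessAt f g)

  <ₘ-irrefl : {m : Maybe (Sym σ)} → ¬ m <ₘ m
  <ₘ-irrefl (just< a<a) = <ₛ-irrefl a<a

  <ₘ-trans : {l m n : Maybe (Sym σ)} → l <ₘ m → m <ₘ n → l <ₘ n
  <ₘ-trans (just< a<b) (just< b<c) = just< (<ₛ-trans a<b b<c)

  <ₘ-compare : {m n : Maybe (Sym σ)} → ∃ (λ a → m ≡ just a) → ∃ (λ b → n ≡ just b) →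
               m <ₘ n ⊎ m ≡ n ⊎ n <ₘ m
  <ₘ-compare (a , refl) (b , refl) with <ₛ-compare a b
  ... | inj₁ a<b        = inj₁ (just< a<b)
  ... | inj₂ (inj₁ refl) = inj₂ (inj₁ refl)
  ... | inj₂ (inj₂ b<a) = inj₂ (inj₂ (just< b<a))

  <ˢ-asym : {f g : Word} → f <ˢ g → ¬ g <ˢ f
  <ˢ-asym {f} {g} (k , f≡g , fk<gk) (l , g≡f , gl<fl) with ℕ.<-cmp k l
  ... | tri< k<l _ _  = <ₘ-irrefl (subst (f k <ₘ_) (g≡f k k<l) fk<gk)
  ... | tri≈ _ refl _ = <ₘ-irrefl (<ₘ-trans fk<gk gl<fl)
  ... | tri> _ _ l<k  = <ₘ-irrefl (subst (g l <ₘ_) (f≡g l l<k) gl<fl)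

  ≗⇒≮ˢ : {f g : Word} → (∀ k → f k ≡ g k) → ¬ g <ˢ f
  ≗⇒≮ˢ f≗g (k , _ , gk<fk) = <ₘ-irrefl (subst (_ <ₘ_) (f≗g k) gk<fk)

  agree-or-differ : {f g : Word} → Defined f → Defined g → ∀ k →
                    (∀ j → j < k → f j ≡ g j) ⊎ ∃ λ j → j < k × (LessAt f g j ⊎ LessAt g f j)
  agree-or-differ f↓ g↓ zero = inj₁ (λ _ ())
  agree-or-differ {f} {g} f↓ g↓ (suc k) with agree-or-differ f↓ g↓ k
  ... | inj₂ (j , j<k , differ) = inj₂ (j , ℕ.m<n⇒m<1+n j<k , differ)
  ... | inj₁ f≡g with <ₘ-compare (f↓ k) (g↓ k)
  ...   | inj₁ fk<gk        = inj₂ (k , ℕ.n<1+n k , inj₁ (f≡g , fk<gk))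
  ...   | inj₂ (inj₂ gk<fk) = inj₂ (k , ℕ.n<1+n k , inj₂ ((λ j j<k → sym (f≡g j j<k)) , gk<fk))
  ...   | inj₂ (inj₁ fk≡gk) = inj₁ f≡g′
    where
    f≡g′ : ∀ j → j < suc k → f j ≡ g j
    f≡g′ j j<1+k with ℕ.m<1+n⇒m<n∨m≡n j<1+k
    ... | inj₁ j<k  = f≡g j j<k
    ... | inj₂ refl = fk≡gk

  -- Constructive comparison: an inequality h < f is decided at a finite position, and
  -- comparing g with f up to that position places g strictly above h or strictly below f.
  <ˢ-cotrans : {f g h : Word} → Defined f → Defined g → h <ˢ f → g <ˢ f ⊎ h <ˢ g
  <ˢ-cotrans {f} {g} {h} f↓ g↓ (k , h≡f , hk<fk) with agree-or-differ f↓ g↓ k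
  ... | inj₂ (j , _ , inj₂ g<f) = inj₁ (j , g<f)
  ... | inj₂ (j , j<k , inj₁ (f≡g , fj<gj)) =
    inj₂ (j , (λ i i<j → trans (h≡f i (ℕ.<-trans i<j j<k)) (f≡g i i<j)) , subst (_<ₘ g j) (sym (h≡f j j<k)) fj<gj)
  ... | inj₁ f≡g with <ₘ-compare (f↓ k) (g↓ k)
  ...   | inj₂ (inj₂ gk<fk) = inj₁ (k , (λ j j<k → sym (f≡g j j<k)) , gk<fk)
  ...   | inj₁ fk<gk        = inj₂ (k , (λ j j<k → trans (h≡f j j<k) (f≡g j j<k)) , <ₘ-trans hk<fk fk<gk)
  ...   | inj₂ (inj₁ fk≡gk) = inj₂ (k , (λ j j<k → trans (h≡f j j<k) (f≡g j j<k)) , subst (h k <ₘ_) fk≡gk hk<fk)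

  ≮ˢ-trans : {f g h : Word} → Defined f → Defined g → ¬ g <ˢ f → ¬ h <ˢ g → ¬ h <ˢ f
  ≮ˢ-trans f↓ g↓ g≮f h≮g h<f = [ g≮f , h≮g ] (<ˢ-cotrans f↓ g↓ h<f)

module _ {A : Set} where

  nth-++ˡ : (S R : List A) {j : ℕ} → j < length S → nth (S ++ R) j ≡ nth S j
  nth-++ˡ (x ∷ S) R {zero}  _         = refl
  nth-++ˡ (x ∷ S) R {suc j} (s≤s j<S) = nth-++ˡ S R j<S

  nth-defined : (S : List A) {k : ℕ} → k < length S → ∃ λ a → nth S k ≡ just a
  nth-defined (x ∷ S) {zero}  _         = x , refl
  nth-defined (x ∷ S) {suc k} (s≤s k<S) = nth-defined S k<S

  length-pow : (S : List A) (n : ℕ) → length (pow S n) ≡ n * length S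
  length-pow S zero    = refl
  length-pow S (suc n) = trans (List.length-++ S) (cong (length S +_) (length-pow S n))

  omega-nth : (S : List A) {j : ℕ} → j < length S → omega S j ≡ nth S j
  omega-nth S {j} = nth-++ˡ S (pow S j)

  length-rot : (i : ℕ) (S : List A) → length (rot i S) ≡ length S
  length-rot i S = trans (List.length-++-comm (drop i S) (take i S)) (cong length (List.take++drop≡id i S))

module _ {σ : ℕ} where

  omega-defined : {S : List (Sym σ)} → ¬ S ≡ [] → Defined (omega S)
  omega-defined {[]}    S≢[] _ = ⊥-elim (S≢[] refl)
  omega-defined {x ∷ S} _    k = nth-defined (pow (x ∷ S) (suc k))
    (subst (k <_) (sym (length-pow (x ∷ S) (suc k))) (ℕ.m≤m*n (suc k) (suc (length S))))

  first-difference : {S T : List (Sym σ)} → length S ≡ length T → S <ₗ T →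
                     ∃ λ k → k < length S × LessAt (nth S) (nth T) k
  first-difference ()        []<∷
  first-difference _         (here x<y)      = 0 , s≤s z≤n , (λ _ ()) , just< x<y
  first-difference |S|≡|T| (there {x} {xs} {ys} xs<ys) with first-difference (ℕ.suc-injective |S|≡|T|) xs<ys
  ... | k , k<|xs| , xs≡ys , xsₖ<ysₖ = suc k , s≤s k<|xs| , x∷xs≡x∷ys , xsₖ<ysₖ
    where
    x∷xs≡x∷ys : ∀ j → j < suc k → nth (x ∷ xs) j ≡ nth (x ∷ ys) j
    x∷xs≡x∷ys zero    _         = refl
    x∷xs≡x∷ys (suc j) (s≤s j<k) = xs≡ys j j<k

  <ₗ⇒<ω : {S T : List (Sym σ)} → length S ≡ length T → S <ₗ T → S <ω T
  <ₗ⇒<ω {S} {T} |S|≡|T| S<T with first-difference |S|≡|T| S<T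
  ... | k , k<|S| , S≡T , Sk<Tk =
    k , ωS≡ωT , subst₂ _<ₘ_ (sym (omega-nth S k<|S|)) (sym (omega-nth T (subst (k <_) |S|≡|T| k<|S|))) Sk<Tk
    where
    ωS≡ωT : ∀ j → j < k → omega S j ≡ omega T j
    ωS≡ωT j j<k = trans (omega-nth S j<|S|) (trans (S≡T j j<k) (sym (omega-nth T (subst (j <_) |S|≡|T| j<|S|))))
      where
      j<|S| : j < length S
      j<|S| = ℕ.<-trans j<k k<|S|

  ≮ω⇒≤ₗ : {S T : List (Sym σ)} → length S ≡ length T → ¬ T <ω S → S ≤ₗ T
  ≮ω⇒≤ₗ {S} {T} |S|≡|T| T≮S = ≮ₗ⇒≤ₗ S T (T≮S ∘ <ₗ⇒<ω (sym |S|≡|T|))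

-- Sublists of sorted-lasts transforms

module _ {A B : Set} {R : A → A → Set} {S : B → B → Set} {g : A → Maybe B}
         (mono : ∀ {x y i j} → R x y → g x ≡ just i → g y ≡ just j → S i j) where

  All-mapMaybe⁺ : ∀ {x i ys} → g x ≡ just i → All (R x) ys → All (S i) (mapMaybe g ys)
  All-mapMaybe⁺ gx [] = []
  All-mapMaybe⁺ {ys = y ∷ _} gx (Rxy ∷ Rxys) with g y in gy
  ... | nothing = All-mapMaybe⁺ gx Rxys
  ... | just j  = mono Rxy gx gy ∷ All-mapMaybe⁺ gx Rxys

  AllPairs-mapMaybe⁺ : ∀ {xs} → AllPairs R xs → AllPairs S (mapMaybe g xs)
  AllPairs-mapMaybe⁺ [] = []
  AllPairs-mapMaybe⁺ {x ∷ _} (Rxs ∷ Rxss) with g x in gx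
  ... | nothing = AllPairs-mapMaybe⁺ Rxss
  ... | just i  = All-mapMaybe⁺ gx Rxs ∷ AllPairs-mapMaybe⁺ Rxss

LastRel : {σ : ℕ} → (Sym σ → Sym σ → Set) → List (Sym σ) → List (Sym σ) → Set
LastRel Rel u v = ∀ {c c′} → last u ≡ just c → last v ≡ just c′ → Rel c c′

module _ {σ : ℕ} {K J : Set} {Rel : Sym σ → Sym σ → Set}
         {ord : K → K → Set} {str : K → List (Sym σ)} {keys : List K}
         {f : J → List (Sym σ)} {js : List J}
         (select : K → Maybe J)
         (lasts : ∀ {k i} → k ∈ keys → select k ≡ just i → LastRel Rel (f i) (str k)) where

  private
    LastsOf : {X : Set} → (X → List (Sym σ)) → List X → List (Sym σ) → Set
    LastsOf h = Pointwise (λ x c → last (h x) ≡ just c)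

  selected-lasts-sublist : {p : List K} {B E : List (Sym σ)} → All (_∈ keys) p →
                           LastsOf f (mapMaybe select p) B → LastsOf str p E → Sublist Rel B E
  selected-lasts-sublist [] [] [] = []
  selected-lasts-sublist {k ∷ _} (k∈ ∷ p∈) B≈ (e ∷ E≈) with select k in sk
  selected-lasts-sublist (k∈ ∷ p∈) B≈       (e ∷ E≈) | nothing = _ ∷ʳ selected-lasts-sublist p∈ B≈ E≈
  selected-lasts-sublist (k∈ ∷ p∈) (b ∷ B≈) (e ∷ E≈) | just i  = lasts k∈ sk b e ∷ selected-lasts-sublist p∈ B≈ E≈

  -- A sorted list of strings is unique, so the selected keys of the arrangement behind E
  -- list the strings f i exactly as the arrangement behind B does.
  IsSortedLasts-sublist :
    mapMaybe select keys ↭ js →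
    (∀ {p} → p ↭ keys → Linked ord p → Linked (λ i j → f i ≤ₗ f j) (mapMaybe select p)) →
    {B E : List (Sym σ)} → IsSortedLasts (λ i j → f i ≤ₗ f j) f js B → IsSortedLasts ord str keys E →
    Sublist Rel B E
  IsSortedLasts-sublist select↭ select↗ {B} (q , q↭ , q↗ , B≈) (p , p↭ , p↗ , E≈) =
    selected-lasts-sublist (All.tabulate (Perm.∈-resp-↭ p↭)) selected-B≈ E≈
    where
    same-strings : map f (mapMaybe select p) ≡ map f q
    same-strings = ↗↭↗⇒≡ (Linked.map⁺ (select↗ p↭ p↗)) (Linked.map⁺ q↗)
      (Perm.map⁺ f (↭-trans (Perm.mapMaybe-↭ select p↭) (↭-trans select↭ (↭-sym q↭))))
    selected-B≈ : LastsOf f (mapMaybe select p) B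
    selected-B≈ = Pointwise.map⁻ f id
      (subst (λ ws → Pointwise (λ w c → last w ≡ just c) ws (map id B)) (sym same-strings) (Pointwise.map⁺ f id B≈))

record RotationsEmbed {σ : ℕ} (Rel : Sym σ → Sym σ → Set) (T : List (Sym σ)) (f : ℕ → List (Sym σ)) : Set where
  field
    ≤ₗ-reflect   : ∀ {i j} → i < length T → j < length T → f i ≤ₗ f j → rot i T ≤ₗ rot j T
    last-related : ∀ {i} → i < length T → LastRel Rel (rot i T) (f i)

open RotationsEmbed

rotationsEmbed-refl : {σ : ℕ} {T : List (Sym σ)} → RotationsEmbed _≡_ T (λ i → rot i T)
rotationsEmbed-refl = record
  { ≤ₗ-reflect   = λ _ _ i≤j → i≤j
  ; last-related = λ _ l l′ → Maybe.just-injective (trans (sym l) l′) }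

-- Extended BWT

rotationOf : ℕ → ℕ × ℕ → Maybe ℕ
rotationOf d (e , i) with e ≟ d
... | yes _ = just i
... | no _  = nothing

rotationOf-self : ∀ d i → rotationOf d (d , i) ≡ just i
rotationOf-self d i with d ≟ d
... | yes _  = refl
... | no d≢d = ⊥-elim (d≢d refl)

rotationOf-other : ∀ {d e} → ¬ e ≡ d → ∀ i → rotationOf d (e , i) ≡ nothing
rotationOf-other {d} {e} e≢d i with e ≟ d
... | yes e≡d = ⊥-elim (e≢d e≡d)
... | no _    = refl

rotationOf-just : ∀ {d e i j} → rotationOf d (e , i) ≡ just j → e ≡ d × i ≡ j
rotationOf-just {d} {e} eq with e ≟ d
rotationOf-just refl | yes e≡d = e≡d , refl
rotationOf-just ()   | no _

module _ {A : Set} where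

  mapMaybe-rotationOf-below : ∀ {D s} (N : List (List A)) → D < s → mapMaybe (rotationOf D) (idxFrom s N) ≡ []
  mapMaybe-rotationOf-below         []      _   = refl
  mapMaybe-rotationOf-below {D} {s} (T ∷ N) D<s =
    trans (List.mapMaybe-++ (rotationOf D) (map (s ,_) (upTo (length T))) (idxFrom (suc s) N))
          (cong₂ _++_ (List.mapMaybe-map-none (rotationOf-other (ℕ.>⇒≢ D<s)) (upTo (length T)))
                      (mapMaybe-rotationOf-below N (ℕ.m<n⇒m<1+n D<s)))

  mapMaybe-rotationOf : ∀ s d (N : List (List A)) →
                        mapMaybe (rotationOf (s + d)) (idxFrom s N) ≡ upTo (length (nthStr N d))
  mapMaybe-rotationOf s d       []      = refl
  mapMaybe-rotationOf s zero    (T ∷ N) rewrite ℕ.+-identityʳ s =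
    trans (List.mapMaybe-++ (rotationOf s) (map (s ,_) (upTo (length T))) (idxFrom (suc s) N))
          (trans (cong₂ _++_ (List.mapMaybe-map-retract (rotationOf-self s) (upTo (length T)))
                             (mapMaybe-rotationOf-below N (ℕ.n<1+n s)))
                 (List.++-identityʳ (upTo (length T))))
  mapMaybe-rotationOf s (suc d) (T ∷ N) rewrite ℕ.+-suc s d =
    trans (List.mapMaybe-++ (rotationOf (suc (s + d))) (map (s ,_) (upTo (length T))) (idxFrom (suc s) N))
          (cong₂ _++_ (List.mapMaybe-map-none (rotationOf-other (ℕ.m≢1+m+n s)) (upTo (length T)))
                      (mapMaybe-rotationOf (suc s) d N))

  idxFrom-∈ : ∀ {s e i} (N : List (List A)) → (e , i) ∈ idxFrom s N → ∃ λ k → e ≡ s + k × i < length (nthStr N k)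
  idxFrom-∈ {s} (T ∷ N) e,i∈ with Membership.∈-++⁻ (map (s ,_) (upTo (length T))) e,i∈
  ... | inj₁ ∈head with Membership.∈-map⁻ (s ,_) ∈head
  ...   | j , j∈ , refl = 0 , sym (ℕ.+-identityʳ s) , Membership.∈-upTo⁻ j∈
  idxFrom-∈ {s} (T ∷ N) _ | inj₂ ∈tail with idxFrom-∈ N ∈tail
  ...   | k , refl , i< = suc k , sym (ℕ.+-suc s k) , i<

module _ {σ : ℕ} (N : List (List (Sym σ))) where

  key-bound : ∀ {e i} → (e , i) ∈ idxFrom 0 N → i < length (nthStr N e)
  key-bound e,i∈ with idxFrom-∈ N e,i∈
  ... | _ , refl , i< = i<

  conj-nonempty : ∀ {x} → x ∈ idxFrom 0 N → ¬ conj N x ≡ []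
  conj-nonempty {e , i} x∈ conj≡[] =
    ℕ.n≮0 (subst (i <_) (trans (sym (length-rot i (nthStr N e))) (cong length conj≡[])) (key-bound x∈))

  _⊑_ : ℕ × ℕ → ℕ × ℕ → Set
  x ⊑ y = x ∈ idxFrom 0 N × y ∈ idxFrom 0 N × ¬ conj N y <ω conj N x

  ⊑-trans : ∀ {x y z} → x ⊑ y → y ⊑ z → x ⊑ z
  ⊑-trans (x∈ , y∈ , y≮x) (_ , z∈ , z≮y) =
    x∈ , z∈ , ≮ˢ-trans (omega-defined (conj-nonempty x∈)) (omega-defined (conj-nonempty y∈)) y≮x z≮y

  ◁⇒≮ω : ∀ {x y} → x ◁[ N ] y → ¬ conj N y <ω conj N x
  ◁⇒≮ω (inj₁ (inj₁ x<ωy))       = <ˢ-asym x<ωy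
  ◁⇒≮ω (inj₁ (inj₂ (x≡ωy , _))) = ≗⇒≮ˢ x≡ωy
  ◁⇒≮ω (inj₂ (_ , y⊀x , _))     = y⊀x ∘ inj₁

  ◁-sorted⇒⊑-sorted : ∀ {p} → All (_∈ idxFrom 0 N) p → Linked (λ x y → x ◁[ N ] y) p → Linked _⊑_ p
  ◁-sorted⇒⊑-sorted []             []         = []
  ◁-sorted⇒⊑-sorted (_ ∷ [])       [-]        = [-]
  ◁-sorted⇒⊑-sorted (x∈ ∷ y∈ ∷ p∈) (x◁y ∷ p◁) = (x∈ , y∈ , ◁⇒≮ω x◁y) ∷ ◁-sorted⇒⊑-sorted (y∈ ∷ p∈) p◁

  ebwt-sublist : ∀ {Rel d T U} → nthStr N d ≡ U → length T ≡ length U → RotationsEmbed Rel T (λ i → rot i U) →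
                 ∀ {B E} → IsBWT T B → IsEBWT N E → Sublist Rel B E
  ebwt-sublist {Rel} {d} {T} refl |T|≡|Nd| emb = IsSortedLasts-sublist {str = conj N} (rotationOf d) lasts select↭ select↗
    where
    bound : ∀ {i} → (d , i) ∈ idxFrom 0 N → i < length T
    bound d,i∈ = subst (_ <_) (sym |T|≡|Nd|) (key-bound d,i∈)

    lasts : ∀ {x i} → x ∈ idxFrom 0 N → rotationOf d x ≡ just i → LastRel Rel (rot i T) (conj N x)
    lasts {e , _} x∈ sx with rotationOf-just sx
    ... | refl , refl = last-related emb (bound x∈)

    select↭ : mapMaybe (rotationOf d) (idxFrom 0 N) ↭ upTo (length T)
    select↭ = ↭-reflexive (trans (mapMaybe-rotationOf 0 d N) (cong upTo (sym |T|≡|Nd|)))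

    mono : ∀ {x y i j} → x ⊑ y → rotationOf d x ≡ just i → rotationOf d y ≡ just j → rot i T ≤ₗ rot j T
    mono {e , _} {e′ , _} {i} {j} (x∈ , y∈ , y≮x) sx sy with rotationOf-just sx | rotationOf-just sy
    ... | refl , refl | refl , refl = ≤ₗ-reflect emb (bound x∈) (bound y∈)
      (≮ω⇒≤ₗ (trans (length-rot i (nthStr N d)) (sym (length-rot j (nthStr N d)))) y≮x)

    select↗ : ∀ {p} → p ↭ idxFrom 0 N → Linked (λ x y → x ◁[ N ] y) p →
              Linked (λ i j → rot i T ≤ₗ rot j T) (mapMaybe (rotationOf d) p)
    select↗ p↭ p↗ = Linked.AllPairs⇒Linked (AllPairs-mapMaybe⁺ mono
      (Linked.Linked⇒AllPairs ⊑-trans (◁-sorted⇒⊑-sorted (All.tabulate (Perm.∈-resp-↭ p↭)) p↗)))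

-- BWT of a string containing T

-- window a m k ≡ just (k ∸ a) if a ≤ k < a + m, and nothing otherwise.
window : ℕ → ℕ → ℕ → Maybe ℕ
window (suc a) m       zero    = nothing
window (suc a) m       (suc k) = window a m k
window zero    zero    k       = nothing
window zero    (suc m) zero    = just zero
window zero    (suc m) (suc k) = Maybe.map suc (window zero m k)

window-just : ∀ a m {k i} → window a m k ≡ just i → k ≡ a + i × i < m
window-just (suc a) m {suc k} wk with window-just a m wk
... | refl , i<m = refl , i<m
window-just zero (suc m) {zero} refl = refl , s≤s z≤n
window-just zero (suc m) {suc k} wk with window zero m k in w
window-just zero (suc m) {suc k} refl | just i with window-just zero m w
... | refl , i<m = refl , s≤s i<m

upTo-suc : ∀ n → upTo (suc n) ≡ 0 ∷ map suc (upTo n)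
upTo-suc n = cong (0 ∷_) (sym (List.map-upTo suc n))

mapMaybe-window : ∀ {a m n} → a + m ≤ n → mapMaybe (window a m) (upTo n) ≡ upTo m
mapMaybe-window {suc a} {m} {suc n} (s≤s a+m≤n) = begin
    mapMaybe (window (suc a) m) (upTo (suc n))
  ≡⟨ cong (mapMaybe (window (suc a) m)) (upTo-suc n) ⟩
    mapMaybe (window (suc a) m) (map suc (upTo n))
  ≡⟨ List.mapMaybe-map (window (suc a) m) suc (upTo n) ⟩
    mapMaybe (window a m) (upTo n)
  ≡⟨ mapMaybe-window a+m≤n ⟩
    upTo m ∎
  where open ≡-Reasoning
mapMaybe-window {zero} {zero} {n} _ = List.mapMaybe-nothing (upTo n)
mapMaybe-window {zero} {suc m} {suc n} (s≤s m≤n) = begin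
    mapMaybe (window zero (suc m)) (upTo (suc n))
  ≡⟨ cong (mapMaybe (window zero (suc m))) (upTo-suc n) ⟩
    0 ∷ mapMaybe (window zero (suc m)) (map suc (upTo n))
  ≡⟨ cong (0 ∷_) (List.mapMaybe-map (window zero (suc m)) suc (upTo n)) ⟩
    0 ∷ mapMaybe (Maybe.map suc ∘ window zero m) (upTo n)
  ≡⟨ cong (0 ∷_) (sym (List.map-mapMaybe suc (window zero m) (upTo n))) ⟩
    0 ∷ map suc (mapMaybe (window zero m) (upTo n))
  ≡⟨ cong (λ xs → 0 ∷ map suc xs) (mapMaybe-window m≤n) ⟩
    0 ∷ map suc (upTo m)
  ≡⟨ sym (upTo-suc m) ⟩
    upTo (suc m) ∎
  where open ≡-Reasoning

module _ {σ : ℕ} {Rel : Sym σ → Sym σ → Set} where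

  bwt-sublist : (a : ℕ) {T X : List (Sym σ)} → a + length T ≤ length X → RotationsEmbed Rel T (λ i → rot (a + i) X) →
                ∀ {B E} → IsBWT T B → IsBWT X E → Sublist Rel B E
  bwt-sublist a {T} {X} a+|T|≤|X| emb =
    IsSortedLasts-sublist {str = λ k → rot k X} (window a (length T)) lasts (↭-reflexive (mapMaybe-window a+|T|≤|X|)) select↗
    where
    lasts : ∀ {k i} → k ∈ upTo (length X) → window a (length T) k ≡ just i → LastRel Rel (rot i T) (rot k X)
    lasts _ wk with window-just a (length T) wk
    ... | refl , i< = last-related emb i<

    mono : ∀ {k l i j} → rot k X ≤ₗ rot l X → window a (length T) k ≡ just i → window a (length T) l ≡ just j →
           rot i T ≤ₗ rot j T
    mono k≤l wk wl with window-just a (length T) wk | window-just a (length T) wl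
    ... | refl , i< | refl , j< = ≤ₗ-reflect emb i< j< k≤l

    select↗ : ∀ {p} → p ↭ upTo (length X) → Linked (λ k l → rot k X ≤ₗ rot l X) p →
              Linked (λ i j → rot i T ≤ₗ rot j T) (mapMaybe (window a (length T)) p)
    select↗ _ p↗ = Linked.AllPairs⇒Linked (AllPairs-mapMaybe⁺ mono (Linked.Linked⇒AllPairs ≤ₗ-trans p↗))

-- Rotations of a block between separators

module _ {A : Set} where

  drop-length-++ : (P : List A) {Y : List A} (i : ℕ) → drop (length P + i) (P ++ Y) ≡ drop i Y
  drop-length-++ []      i = refl
  drop-length-++ (_ ∷ P) i = drop-length-++ P i

  take-length-++ : (P : List A) {Y : List A} (i : ℕ) → take (length P + i) (P ++ Y) ≡ P ++ take i Y
  take-length-++ []      i = refl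
  take-length-++ (x ∷ P) i = cong (x ∷_) (take-length-++ P i)

  drop-++-≤ : (T : List A) {Z : List A} {i : ℕ} → i ≤ length T → drop i (T ++ Z) ≡ drop i T ++ Z
  drop-++-≤ T       {i = zero}  _         = refl
  drop-++-≤ (_ ∷ T) {i = suc _} (s≤s i≤T) = drop-++-≤ T i≤T

  take-++-≤ : (T : List A) {Z : List A} {i : ℕ} → i ≤ length T → take i (T ++ Z) ≡ take i T
  take-++-≤ T       {i = zero}  _         = refl
  take-++-≤ (x ∷ T) {i = suc _} (s≤s i≤T) = cong (x ∷_) (take-++-≤ T i≤T)

  rot-middle : (P T C : List A) (s : A) {i : ℕ} → i ≤ length T →
               rot (length P + i) (P ++ T ++ s ∷ C) ≡ drop i T ++ s ∷ (C ++ P ++ take i T)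
  rot-middle P T C s {i} i≤T = begin
      drop (length P + i) (P ++ T ++ s ∷ C) ++ take (length P + i) (P ++ T ++ s ∷ C)
    ≡⟨ cong₂ _++_ (drop-length-++ P i) (take-length-++ P i) ⟩
      drop i (T ++ s ∷ C) ++ P ++ take i (T ++ s ∷ C)
    ≡⟨ cong₂ (λ u v → u ++ P ++ v) (drop-++-≤ T i≤T) (take-++-≤ T i≤T) ⟩
      (drop i T ++ s ∷ C) ++ P ++ take i T
    ≡⟨ List.++-assoc (drop i T) (s ∷ C) (P ++ take i T) ⟩
      drop i T ++ s ∷ (C ++ P ++ take i T) ∎
    where open ≡-Reasoning

  length-∷ʳ : (xs : List A) {x : A} → length (xs ++ x ∷ []) ≡ suc (length xs)
  length-∷ʳ xs = trans (List.length-++ xs) (ℕ.+-comm (length xs) 1)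

  last-++ʳ : (xs : List A) {ys : List A} → ¬ ys ≡ [] → last (xs ++ ys) ≡ last ys
  last-++ʳ xs           {[]}    ys≢[] = ⊥-elim (ys≢[] refl)
  last-++ʳ []                   _     = refl
  last-++ʳ (_ ∷ [])     {_ ∷ _} _     = refl
  last-++ʳ (_ ∷ x ∷ xs)         ys≢[] = last-++ʳ (x ∷ xs) ys≢[]

  EndsWith : (A → Set) → List A → Set
  EndsWith P xs = Maybe.All P (last xs)

  ∷ʳ-endsWith : {P : A → Set} (xs : List A) {x : A} → P x → EndsWith P (xs ++ x ∷ [])
  ∷ʳ-endsWith {P} xs Px = subst (Maybe.All P) (sym (last-++ʳ xs λ ())) (Maybe.just Px)

  ++-endsWith : {P : A → Set} (xs ys : List A) → EndsWith P xs → EndsWith P ys → EndsWith P (xs ++ ys)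
  ++-endsWith {P} xs []      Pxs _   = subst (EndsWith P) (sym (List.++-identityʳ xs)) Pxs
  ++-endsWith {P} xs (_ ∷ _) _   Pys = subst (Maybe.All P) (sym (last-++ʳ xs λ ())) Pys

  concat-endsWith : {P : A → Set} {xss : List (List A)} → All (EndsWith P) xss → EndsWith P (concat xss)
  concat-endsWith []           = Maybe.nothing
  concat-endsWith {xss = xs ∷ xss} (Pxs ∷ Pxss) = ++-endsWith xs (concat xss) Pxs (concat-endsWith Pxss)

module _ {σ : ℕ} where

  BelowLetters : Sym σ → Set
  BelowLetters s = ∀ a → s <ₛ ch a

  ≤ₗ-∷⁻ : {x y : Sym σ} {S T : List (Sym σ)} → (x ∷ S) ≤ₗ (y ∷ T) → x <ₛ y ⊎ (x ≡ y × S ≤ₗ T)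
  ≤ₗ-∷⁻ (inj₁ x∷S≡y∷T) with List.∷-injective x∷S≡y∷T
  ... | x≡y , S≡T = inj₂ (x≡y , inj₁ S≡T)
  ≤ₗ-∷⁻ (inj₂ (here x<y))  = inj₁ x<y
  ≤ₗ-∷⁻ (inj₂ (there S<T)) = inj₂ (refl , inj₂ S<T)

  -- Strings of letters of different lengths are told apart at the first separator, so
  -- neither the separator nor anything after it affects their order.
  separated-≤ₗ⇒<ₗ : {s s′ : Sym σ} {Y Z Y′ Z′ : List (Sym σ)} → BelowLetters s → BelowLetters s′ →
                    (u v : List (Fin σ)) → ¬ length u ≡ length v →
                    (embed u ++ s ∷ Y) ≤ₗ (embed v ++ s ∷ Z) → (embed u ++ s′ ∷ Y′) <ₗ (embed v ++ s′ ∷ Z′)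
  separated-≤ₗ⇒<ₗ _   _    []      []      |u|≢|v| _ = ⊥-elim (|u|≢|v| refl)
  separated-≤ₗ⇒<ₗ _   s′<Σ []      (b ∷ _) _       _ = here (s′<Σ b)
  separated-≤ₗ⇒<ₗ s<Σ _    (a ∷ _) []      _       a∷u≤s∷Z with ≤ₗ-∷⁻ a∷u≤s∷Z
  ... | inj₁ a<s        = ⊥-elim (<ₛ-irrefl (<ₛ-trans a<s (s<Σ a)))
  ... | inj₂ (refl , _) = ⊥-elim (<ₛ-irrefl (s<Σ a))
  separated-≤ₗ⇒<ₗ s<Σ s′<Σ (a ∷ u) (b ∷ v) |u|≢|v| a∷u≤b∷v with ≤ₗ-∷⁻ a∷u≤b∷v
  ... | inj₁ a<b          = here a<b
  ... | inj₂ (refl , u≤v) = there (separated-≤ₗ⇒<ₗ s<Σ s′<Σ u v (|u|≢|v| ∘ cong suc) u≤v)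

  rot-block : (P : List (Sym σ)) (W : List (Fin σ)) (C : List (Sym σ)) (s : Sym σ) {i : ℕ} → i ≤ length W →
              rot (length P + i) (P ++ embed W ++ s ∷ C) ≡ embed (drop i W) ++ s ∷ (C ++ P ++ embed (take i W))
  rot-block P W C s {i} i≤W =
    trans (rot-middle P (embed W) C s (subst (i ≤_) (sym (List.length-map ch W)) i≤W))
          (cong₂ (λ u v → u ++ s ∷ (C ++ P ++ v)) (List.drop-map i W) (List.take-map i W))

  embed-take-suc≢[] : (W : List (Fin σ)) {k : ℕ} → suc k ≤ length W → ¬ embed (take (suc k) W) ≡ []
  embed-take-suc≢[] (_ ∷ _) _ ()

  -- s ∷ C ++ P is what follows W cyclically, so its last character is the one preceding W.
  separated-rotationsEmbed : (P : List (Sym σ)) (W : List (Fin σ)) (C : List (Sym σ)) {s : Sym σ} →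
    BelowLetters s → EndsWith IsSep (s ∷ C ++ P) →
    RotationsEmbed RenSep (dollar (embed W)) (λ i → rot (length P + i) (P ++ embed W ++ s ∷ C))
  separated-rotationsEmbed P W C {s} s<Σ sep = record { ≤ₗ-reflect = reflect ; last-related = related }
    where
    W$ : List (Sym σ)
    W$ = dollar (embed W)

    X : List (Sym σ)
    X = P ++ embed W ++ s ∷ C

    bound : ∀ {i} → i < length W$ → i ≤ length W
    bound {i} i< = ℕ.m<1+n⇒m≤n (subst (i <_) |W$|≡1+|W| i<)
      where
      |W$|≡1+|W| : length W$ ≡ suc (length W)
      |W$|≡1+|W| = trans (length-∷ʳ (embed W)) (cong suc (List.length-map ch W))

    reflect : ∀ {i j} → i < length W$ → j < length W$ → rot (length P + i) X ≤ₗ rot (length P + j) X →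
              rot i W$ ≤ₗ rot j W$
    reflect {i} {j} i< j< i≤j with i ≟ j
    ... | yes refl = inj₁ refl
    ... | no i≢j   = inj₂ (subst₂ _<ₗ_ (sym (rot-block [] W [] dol (bound i<))) (sym (rot-block [] W [] dol (bound j<)))
      (separated-≤ₗ⇒<ₗ s<Σ (λ _ → $<c) (drop i W) (drop j W) |drop|≢
        (subst₂ _≤ₗ_ (rot-block P W C s (bound i<)) (rot-block P W C s (bound j<)) i≤j)))
      where
      |drop|≢ : ¬ length (drop i W) ≡ length (drop j W)
      |drop|≢ eq = i≢j (ℕ.∸-cancelˡ-≡ (bound i<) (bound j<)
        (trans (sym (List.length-drop i W)) (trans eq (List.length-drop j W))))

    related : ∀ {i} → i < length W$ → LastRel RenSep (rot i W$) (rot (length P + i) X)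
    related {zero} _ l l′ =
      inj₂ (Maybe.just-injective (trans (sym l) last-W$) , Maybe.drop-just (subst (Maybe.All IsSep) (trans (sym last-X) l′) sep))
      where
      last-W$ : last (rot 0 W$) ≡ just dol
      last-W$ = trans (cong last (rot-block [] W [] dol z≤n)) (last-++ʳ (embed W) λ ())
      last-X : last (rot (length P + 0) X) ≡ last (s ∷ C ++ P)
      last-X = trans (cong last (rot-block P W C s z≤n))
                     (trans (last-++ʳ (embed W) λ ()) (cong (λ Q → last (s ∷ C ++ Q)) (List.++-identityʳ P)))
    related {suc k} k< l l′ = inj₁ (Maybe.just-injective (trans (sym l) (trans last-W$ (trans (sym last-X) l′))))
      where
      Wₖ : List (Sym σ)
      Wₖ = embed (take (suc k) W)
      Wₖ≢[] : ¬ Wₖ ≡ []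
      Wₖ≢[] = embed-take-suc≢[] W (bound k<)
      last-W$ : last (rot (suc k) W$) ≡ last Wₖ
      last-W$ = trans (cong last (rot-block [] W [] dol (bound k<)))
                      (trans (last-++ʳ (embed (drop (suc k) W)) λ ()) (last-++ʳ (dol ∷ []) Wₖ≢[]))
      last-X : last (rot (length P + suc k) X) ≡ last Wₖ
      last-X = trans (cong last (rot-block P W C s (bound k<)))
                     (trans (last-++ʳ (embed (drop (suc k) W)) λ ())
                       (trans (last-++ʳ (s ∷ C) (Wₖ≢[] ∘ List.++-conicalʳ P Wₖ)) (last-++ʳ P Wₖ≢[])))

  bwt-middle-sublist : (P : List (Sym σ)) (W : List (Fin σ)) (C : List (Sym σ)) {s : Sym σ} {X : List (Sym σ)} →
    BelowLetters s → EndsWith IsSep (s ∷ C ++ P) → X ≡ P ++ embed W ++ s ∷ C →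
    ∀ {B E} → IsBWT (dollar (embed W)) B → IsBWT X E → SubseqRen B E
  bwt-middle-sublist P W C {s} s<Σ sep refl = bwt-sublist (length P) fits (separated-rotationsEmbed P W C s<Σ sep)
    where
    open ℕ.≤-Reasoning
    fits : length P + length (dollar (embed W)) ≤ length (P ++ embed W ++ s ∷ C)
    fits = begin
      length P + length (embed W ++ dol ∷ [])         ≡⟨ cong (length P +_) (List.length-++ (embed W)) ⟩
      length P + (length (embed W) + 1)               ≤⟨ ℕ.+-monoʳ-≤ (length P) (ℕ.+-monoʳ-≤ (length (embed W)) (s≤s z≤n)) ⟩
      length P + (length (embed W) + length (s ∷ C))  ≡⟨ cong (length P +_) (List.length-++ (embed W)) ⟨
      length P + length (embed W ++ s ∷ C)            ≡⟨ List.length-++ P ⟨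
      length (P ++ embed W ++ s ∷ C)                  ∎

module _ {A : Set} where

  concat-split : (Bs : List (List A)) {d : ℕ} {T : List A} {s : A} (Z : List A) → nthStr Bs d ≡ T ++ s ∷ [] →
                 concat Bs ++ Z ≡ concat (take d Bs) ++ T ++ s ∷ (concat (drop (suc d) Bs) ++ Z)
  concat-split [] {T = T} _ []≡T∷ʳs with List.++-conicalʳ T _ (sym []≡T∷ʳs)
  ... | ()
  concat-split (_ ∷ Bs) {zero} {T} {s} Z refl = begin
      ((T ++ s ∷ []) ++ concat Bs) ++ Z  ≡⟨ List.++-assoc (T ++ s ∷ []) (concat Bs) Z ⟩
      (T ++ s ∷ []) ++ concat Bs ++ Z    ≡⟨ List.++-assoc T (s ∷ []) (concat Bs ++ Z) ⟩
      T ++ s ∷ (concat Bs ++ Z)          ∎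
    where open ≡-Reasoning
  concat-split (B ∷ Bs) {suc d} {T} {s} Z Bsᵈ≡T∷ʳs = begin
      (B ++ concat Bs) ++ Z                    ≡⟨ List.++-assoc B (concat Bs) Z ⟩
      B ++ concat Bs ++ Z                      ≡⟨ cong (B ++_) (concat-split Bs Z Bsᵈ≡T∷ʳs) ⟩
      B ++ concat (take d Bs) ++ T ++ s ∷ R    ≡⟨ List.++-assoc B (concat (take d Bs)) (T ++ s ∷ R) ⟨
      (B ++ concat (take d Bs)) ++ T ++ s ∷ R  ∎
    where
    open ≡-Reasoning
    R : List A
    R = concat (drop (suc d) Bs) ++ Z

module _ {A B : Set} where

  nthStr-map : (f : List A → List B) (N : List (List A)) {d : ℕ} → d < length N → nthStr (map f N) d ≡ f (nthStr N d)
  nthStr-map f (_ ∷ _) {zero}  _         = refl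
  nthStr-map f (_ ∷ N) {suc d} (s≤s d<N) = nthStr-map f N d<N

module _ {σ : ℕ} where

  nthStr-multiDollarFrom : (j : ℕ) (N : List (List (Sym σ))) {d : ℕ} → d < length N →
                           nthStr (multiDollarFrom j N) d ≡ nthStr N d ++ dolI (j + d) ∷ []
  nthStr-multiDollarFrom j (_ ∷ _) {zero}  _         rewrite ℕ.+-identityʳ j = refl
  nthStr-multiDollarFrom j (_ ∷ N) {suc d} (s≤s d<N) rewrite ℕ.+-suc j d = nthStr-multiDollarFrom (suc j) N d<N

  multiDollarFrom-endsWithSep : (j : ℕ) (N : List (List (Sym σ))) → All (EndsWith IsSep) (multiDollarFrom j N)
  multiDollarFrom-endsWithSep j []      = []
  multiDollarFrom-endsWithSep j (T ∷ N) = ∷ʳ-endsWith T (inj₂ (inj₁ (j , refl))) ∷ multiDollarFrom-endsWithSep (suc j) N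

  dollar-endsWithSep : (N : List (List (Sym σ))) → All (EndsWith IsSep) (map dollar N)
  dollar-endsWithSep N = All.map⁺ (All.universal (λ T → ∷ʳ-endsWith T (inj₁ refl)) N)

  bwt-blocks-sublist : (Bs : List (List (Sym σ))) (d : ℕ) (W : List (Fin σ)) {s : Sym σ} (Z : List (Sym σ)) {X : List (Sym σ)} →
    All (EndsWith IsSep) Bs → EndsWith IsSep Z → IsSep s → BelowLetters s →
    nthStr Bs d ≡ embed W ++ s ∷ [] → X ≡ concat Bs ++ Z →
    ∀ {B E} → IsBWT (dollar (embed W)) B → IsBWT X E → SubseqRen B E
  bwt-blocks-sublist Bs d W {s} Z Bs-sep Z-sep s-sep s<Σ Bsᵈ≡W∷ʳs X≡ =
    bwt-middle-sublist P W C s<Σ sep (trans X≡ (concat-split Bs Z Bsᵈ≡W∷ʳs))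
    where
    P C : List (Sym σ)
    P = concat (take d Bs)
    C = concat (drop (suc d) Bs) ++ Z
    sep : EndsWith IsSep (s ∷ C ++ P)
    sep = ++-endsWith (s ∷ []) (C ++ P) (Maybe.just s-sep)
            (++-endsWith C P (++-endsWith (concat (drop (suc d) Bs)) Z (concat-endsWith (All.drop⁺ (suc d) Bs-sep)) Z-sep)
                             (concat-endsWith (All.take⁺ d Bs-sep)))

-- Nonemptiness of the strings is not needed: conjugate indices are in range by construction.
lemma10 : (σ : ℕ) (M : List (List (Fin σ))) → All NonEmpty M →
          (d : ℕ) → d < length M →
          ((B E : List (Sym σ)) → IsBWT (embed (nthStr M d)) B → IsEBWT (embedAll M) E → Subseq B E)
          × ((B E : List (Sym σ)) → IsBWT (dollar (embed (nthStr M d))) B → IsDolEBWT M E → Subseq B E)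
          × ((B E : List (Sym σ)) → IsBWT (dollar (embed (nthStr M d))) B → IsMdolEBWT M E → SubseqRen B E)
          × ((B E : List (Sym σ)) → IsBWT (dollar (embed (nthStr M d))) B → IsMdolBWT M E → SubseqRen B E)
          × ((B E : List (Sym σ)) → IsBWT (dollar (embed (nthStr M d))) B → IsConcatBWT M E → SubseqRen B E)
lemma10 σ M _ d d<|M| =
    (λ _ _ → ebwt-sublist N Nᵈ≡W refl rotationsEmbed-refl)
  , (λ _ _ → ebwt-sublist (map dollar N) N$ᵈ≡W$ refl rotationsEmbed-refl)
  , (λ _ _ → ebwt-sublist (multiDollar N) Nᵐᵈ≡W$ᵈ (trans (length-∷ʳ (embed W)) (sym (length-∷ʳ (embed W))))
                 (separated-rotationsEmbed [] W [] (λ _ → $ᵢ<c) (Maybe.just $ᵈ-sep)))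
  , (λ _ _ → bwt-blocks-sublist (multiDollar N) d W [] (multiDollarFrom-endsWithSep 1 N) Maybe.nothing $ᵈ-sep (λ _ → $ᵢ<c)
                 Nᵐᵈ≡W$ᵈ (sym (List.++-identityʳ _)))
  , (λ _ _ → bwt-blocks-sublist (map dollar N) d W (hash ∷ []) (dollar-endsWithSep N) (Maybe.just (inj₂ (inj₂ refl)))
                 (inj₁ refl) (λ _ → $<c) N$ᵈ≡W$ refl)
  where
  W : List (Fin σ)
  W = nthStr M d

  N : List (List (Sym σ))
  N = embedAll M

  d<|N| : d < length N
  d<|N| = subst (d <_) (sym (List.length-map embed M)) d<|M|

  Nᵈ≡W : nthStr N d ≡ embed W
  Nᵈ≡W = nthStr-map embed M d<|M|

  N$ᵈ≡W$ : nthStr (map dollar N) d ≡ dollar (embed W)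
  N$ᵈ≡W$ = trans (nthStr-map dollar N d<|N|) (cong dollar Nᵈ≡W)

  $ᵈ-sep : IsSep {σ} (dolI (suc d))
  $ᵈ-sep = inj₂ (inj₁ (suc d , refl))

  Nᵐᵈ≡W$ᵈ : nthStr (multiDollar N) d ≡ embed W ++ dolI (suc d) ∷ []
  Nᵐᵈ≡W$ᵈ = trans (nthStr-multiDollarFrom 1 N d<|N|) (cong (_++ dolI (suc d) ∷ []) Nᵈ≡W)
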